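{- Let $(X,\mathcal{B})$ be an $(n,k,p,2;j)$-lottery design and let $I\subseteq X$ be a maximal (with respect to inclusion) independent set. Let $\mathcal{B}_I$ be the set of blocks meeting $I$. Then \[|\mathcal{B}_I|\ge\left\lceil\frac{n-p+1}{k-1}\right\rceil.\]
   Context: An $(n,k,p,t;j)$-lottery design is a $k$-uniform hypergraph $(X,\mathcal{B})$ (all blocks of size $k$, $n\ge k\ge t\ge 2$) with $|X|=n$, $|\mathcal{B}|=j$, such that every $D\subseteq X$ with $|D|=p$ satisfies $|B\cap D|\ge t$ for some $B\in\mathcal{B}$. Two vertices are adjacent if they lie in a common block; an independent set is a set of pairwise non-adjacent vertices. -}

module Defs where

open import Data.Nat using (ℕ; zero; suc; _+_; _∸_; _≤_)
open import Data.Nat.DivMod using (_/_)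
open import Data.Fin using (Fin)
open import Data.Fin.Subset using (Subset; _∈_; _∩_; _⊆_; ∣_∣; Nonempty)
open import Data.Fin.Subset.Properties using (nonempty?)
open import Data.Vec using (tabulate)
open import Data.Product using (∃; _×_)
open import Relation.Nullary using (¬_; does)
open import Relation.Binary.PropositionalEquality using (_≡_)

-- ceiling of a / b for b ≥ 1 (value 0 for b = 0, never used)
⌈_/_⌉ : ℕ → ℕ → ℕ
⌈ a / zero ⌉ = 0
⌈ a / suc b ⌉ = (a + b) / suc b

-- A hypergraph on X = Fin n with j blocks, given as an indexed family.
-- Blocks form a set: the indexing is injective.
Blocks : ℕ → ℕ → Set
Blocks n j = Fin j → Subset n

record IsLotteryDesign (n k p t j : ℕ) (B : Blocks n j) : Set where
  field
    t≥2      : 2 ≤ t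
    t≤k      : t ≤ k
    k≤n      : k ≤ n
    distinct : ∀ a b → B a ≡ B b → a ≡ b
    uniform  : ∀ a → ∣ B a ∣ ≡ k
    covers   : ∀ (D : Subset n) → ∣ D ∣ ≡ p → ∃ λ a → t ≤ ∣ B a ∩ D ∣

Adjacent : ∀ {n j} → Blocks n j → Fin n → Fin n → Set
Adjacent B x y = ¬ (x ≡ y) × ∃ λ a → x ∈ B a × y ∈ B a

Independent : ∀ {n j} → Blocks n j → Subset n → Set
Independent B I = ∀ x y → x ∈ I → y ∈ I → ¬ Adjacent B x y

MaximalIndependent : ∀ {n j} → Blocks n j → Subset n → Set
MaximalIndependent B I =
  Independent B I × (∀ J → Independent B J → I ⊆ J → J ⊆ I)

blocksMeeting : ∀ {n j} → Blocks n j → Subset n → Subset j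
blocksMeeting B I = tabulate (λ a → does (nonempty? (B a ∩ I)))

-- Since t = 2, a block meets an independent set I in at most one point, so no p-subset of I
-- is covered and |I| ≤ p − 1.  By maximality every vertex outside I lies in a block meeting I
-- (otherwise it could be added to I), so X is the union of I with the blocks of B_I; each of
-- these already contains a point of I and so adds at most k − 1 vertices.  Hence
-- n ≤ p − 1 + (k − 1)|B_I|.

module Submission where

open import Defs
open import Data.Nat using (ℕ; zero; suc; _+_; _∸_; _*_; _≤_; _<_; z≤n; s≤s)
open import Data.Nat.Properties
open import Data.Nat.DivMod using (_/_; m<n*o⇒m/o<n)
open import Algebra.Properties.CommutativeSemigroup +-commutativeSemigroup using (x∙yz≈y∙xz)
open import Data.Fin using (zero; suc)
import Data.Fin.Properties as Fin
open import Data.Fin.Subset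
open import Data.Fin.Subset.Properties
open import Data.Vec using ([]; _∷_; here; there)
open import Data.Vec.Functional using (tail)
open import Function using (_∘_)
open import Data.Product using (∃; _×_; _,_)
open import Data.Sum using (inj₁; inj₂)
open import Data.Empty using (⊥-elim)
open import Relation.Nullary using (yes; no)
open import Relation.Nullary.Decidable using (decidable-stable)
open import Relation.Binary.PropositionalEquality using (_≡_; refl; sym; trans; cong; subst)

private
  variable
    n j : ℕ

∣p∪q∣+∣p∩q∣≡∣p∣+∣q∣ : ∀ (p q : Subset n) → ∣ p ∪ q ∣ + ∣ p ∩ q ∣ ≡ ∣ p ∣ + ∣ q ∣
∣p∪q∣+∣p∩q∣≡∣p∣+∣q∣ []            []            = refl
∣p∪q∣+∣p∩q∣≡∣p∣+∣q∣ (inside  ∷ p) (inside  ∷ q)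
  rewrite +-suc ∣ p ∪ q ∣ ∣ p ∩ q ∣ | +-suc ∣ p ∣ ∣ q ∣ =
  cong (λ m → suc (suc m)) (∣p∪q∣+∣p∩q∣≡∣p∣+∣q∣ p q)
∣p∪q∣+∣p∩q∣≡∣p∣+∣q∣ (inside  ∷ p) (outside ∷ q) = cong suc (∣p∪q∣+∣p∩q∣≡∣p∣+∣q∣ p q)
∣p∪q∣+∣p∩q∣≡∣p∣+∣q∣ (outside ∷ p) (inside  ∷ q)
  rewrite +-suc ∣ p ∣ ∣ q ∣ = cong suc (∣p∪q∣+∣p∩q∣≡∣p∣+∣q∣ p q)
∣p∪q∣+∣p∩q∣≡∣p∣+∣q∣ (outside ∷ p) (outside ∷ q) = ∣p∪q∣+∣p∩q∣≡∣p∣+∣q∣ p q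

nonempty⇒∣p∣>0 : {p : Subset n} → Nonempty p → 0 < ∣ p ∣
nonempty⇒∣p∣>0 {p = p} (x , x∈p) = subst (_≤ ∣ p ∣) (∣⁅x⁆∣≡1 x)
  (p⊆q⇒∣p∣≤∣q∣ (λ y∈⁅x⁆ → subst (_∈ p) (sym (x∈⁅y⁆⇒x≡y x y∈⁅x⁆)) x∈p))

p∩q≢∅⇒∣p∪q∣<∣p∣+∣q∣ : ∀ (p q : Subset n) → Nonempty (p ∩ q) → ∣ p ∪ q ∣ < ∣ p ∣ + ∣ q ∣
p∩q≢∅⇒∣p∪q∣<∣p∣+∣q∣ p q p∩q≢∅ = begin-strict
  ∣ p ∪ q ∣                ≡⟨ +-identityʳ _ ⟨
  ∣ p ∪ q ∣ + 0            <⟨ +-monoʳ-< ∣ p ∪ q ∣ (nonempty⇒∣p∣>0 p∩q≢∅) ⟩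
  ∣ p ∪ q ∣ + ∣ p ∩ q ∣    ≡⟨ ∣p∪q∣+∣p∩q∣≡∣p∣+∣q∣ p q ⟩
  ∣ p ∣ + ∣ q ∣            ∎
  where open ≤-Reasoning

∩-monoʳ-⊆ : ∀ (p : Subset n) {q r} → q ⊆ r → p ∩ q ⊆ p ∩ r
∩-monoʳ-⊆ p q⊆r x∈p∩q with x∈p∩q⁻ p _ x∈p∩q
... | x∈p , x∈q = x∈p∩q⁺ (x∈p , q⊆r x∈q)

subset-of-size : ∀ (S : Subset n) {m} → m ≤ ∣ S ∣ → ∃ λ D → D ⊆ S × ∣ D ∣ ≡ m
subset-of-size {n} S {zero} _ = ⊥ , ⊥⊆ , ∣⊥∣≡0 n
subset-of-size (inside ∷ S) {suc m} (s≤s m≤∣S∣) with subset-of-size S m≤∣S∣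
... | D , D⊆S , ∣D∣≡m = inside ∷ D , s⊆s D⊆S , cong suc ∣D∣≡m
subset-of-size (outside ∷ S) {suc m} m<∣S∣ with subset-of-size S m<∣S∣
... | D , D⊆S , ∣D∣≡m = outside ∷ D , s⊆s D⊆S , ∣D∣≡m

subsingleton⇒∣p∣≤1 : ∀ (p : Subset n) → (∀ {x y} → x ∈ p → y ∈ p → x ≡ y) → ∣ p ∣ ≤ 1
subsingleton⇒∣p∣≤1 []            _   = z≤n
subsingleton⇒∣p∣≤1 (outside ∷ p) sub =
  subsingleton⇒∣p∣≤1 p (λ x∈p y∈p → Fin.suc-injective (sub (there x∈p) (there y∈p)))
subsingleton⇒∣p∣≤1 {suc n} (inside ∷ p) sub = s≤s (≤-reflexive (trans (cong ∣_∣ p≡⊥) (∣⊥∣≡0 n)))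
  where
  p≡⊥ : p ≡ ⊥
  p≡⊥ = Empty-unique (λ (x , x∈p) → Fin.0≢1+n (sub here (there x∈p)))

m≤n*o⇒⌈m/n⌉≤o : ∀ m n o → m ≤ suc n * o → ⌈ m / suc n ⌉ ≤ o
m≤n*o⇒⌈m/n⌉≤o m n o m≤n*o = ≤-pred (m<n*o⇒m/o<n (begin-strict
  m + n                ≤⟨ +-monoˡ-≤ n m≤n*o ⟩
  suc n * o + n        <⟨ +-monoʳ-< (suc n * o) (n<1+n n) ⟩
  suc n * o + suc n    ≡⟨ cong (_+ suc n) (*-comm (suc n) o) ⟩
  o * suc n + suc n    ≡⟨ +-comm (o * suc n) (suc n) ⟩
  suc o * suc n        ∎))
  where open ≤-Reasoning

independent⇒∣B∩I∣≤1 : ∀ (B : Blocks n j) {I} → Independent B I → ∀ a → ∣ B a ∩ I ∣ ≤ 1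
independent⇒∣B∩I∣≤1 B {I} indep a = subsingleton⇒∣p∣≤1 (B a ∩ I) λ {x} {y} x∈B∩I y∈B∩I →
  let x∈B , x∈I = x∈p∩q⁻ (B a) I x∈B∩I
      y∈B , y∈I = x∈p∩q⁻ (B a) I y∈B∩I
  in decidable-stable (x Fin.≟ y) λ x≢y → indep x y x∈I y∈I (x≢y , a , x∈B , y∈B)

independent⇒∣I∣<p : ∀ (B : Blocks n j) {k p t I} →
  IsLotteryDesign n k p t j B → Independent B I → ∣ I ∣ < p
independent⇒∣I∣<p B {t = t} {I} design indep = ≰⇒> λ p≤∣I∣ →
  let D , D⊆I , ∣D∣≡p = subset-of-size I p≤∣I∣
      a , t≤∣B∩D∣      = covers D ∣D∣≡p
  in 1+n≰n (begin
    2              ≤⟨ t≥2 ⟩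
    t              ≤⟨ t≤∣B∩D∣ ⟩
    ∣ B a ∩ D ∣    ≤⟨ p⊆q⇒∣p∣≤∣q∣ (∩-monoʳ-⊆ (B a) D⊆I) ⟩
    ∣ B a ∩ I ∣    ≤⟨ independent⇒∣B∩I∣≤1 B indep a ⟩
    1              ∎)
  where
  open IsLotteryDesign design
  open ≤-Reasoning

closedNeighbourhood : Blocks n j → Subset n → Subset n
closedNeighbourhood {j = zero}  B I = I
closedNeighbourhood {j = suc j} B I with nonempty? (B zero ∩ I)
... | yes _ = B zero ∪ closedNeighbourhood (tail B) I
... | no  _ = closedNeighbourhood (tail B) I

I⊆closedNeighbourhood : ∀ (B : Blocks n j) I → I ⊆ closedNeighbourhood B I
I⊆closedNeighbourhood {j = zero}  B I x∈I = x∈I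
I⊆closedNeighbourhood {j = suc j} B I x∈I with nonempty? (B zero ∩ I)
... | yes _ = q⊆p∪q (B zero) _ (I⊆closedNeighbourhood (tail B) I x∈I)
... | no  _ = I⊆closedNeighbourhood (tail B) I x∈I

B⊆closedNeighbourhood : ∀ (B : Blocks n j) I a → Nonempty (B a ∩ I) → B a ⊆ closedNeighbourhood B I
B⊆closedNeighbourhood {j = suc j} B I a B∩I≢∅ x∈B with nonempty? (B zero ∩ I) | a
... | yes _      | zero  = p⊆p∪q _ x∈B
... | yes _      | suc a = q⊆p∪q (B zero) _ (B⊆closedNeighbourhood (tail B) I a B∩I≢∅ x∈B)
... | no  B∩I≡∅  | zero  = ⊥-elim (B∩I≡∅ B∩I≢∅)
... | no  _      | suc a = B⊆closedNeighbourhood (tail B) I a B∩I≢∅ x∈B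

∣closedNeighbourhood∣≤ : ∀ {k} (B : Blocks n j) I → (∀ a → ∣ B a ∣ ≡ suc k) →
  ∣ closedNeighbourhood B I ∣ ≤ ∣ I ∣ + k * ∣ blocksMeeting B I ∣
∣closedNeighbourhood∣≤ {j = zero}      B I uniform = m≤m+n _ _
∣closedNeighbourhood∣≤ {j = suc j} {k} B I uniform with nonempty? (B zero ∩ I)
... | no  _ = ∣closedNeighbourhood∣≤ (tail B) I (uniform ∘ suc)
... | yes (x , x∈B∩I) = ≤-pred (begin-strict
  ∣ B zero ∪ C ∣             <⟨ p∩q≢∅⇒∣p∪q∣<∣p∣+∣q∣ (B zero) C (x , x∈B∩C) ⟩
  ∣ B zero ∣ + ∣ C ∣         ≡⟨ cong (_+ ∣ C ∣) (uniform zero) ⟩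
  suc k + ∣ C ∣              ≤⟨ +-monoʳ-≤ (suc k) (∣closedNeighbourhood∣≤ (tail B) I (uniform ∘ suc)) ⟩
  suc k + (∣ I ∣ + k * m)    ≡⟨ cong suc (x∙yz≈y∙xz k ∣ I ∣ (k * m)) ⟩
  suc (∣ I ∣ + (k + k * m))  ≡⟨ cong (λ l → suc (∣ I ∣ + l)) (*-suc k m) ⟨
  suc (∣ I ∣ + k * suc m)    ∎)
  where
  open ≤-Reasoning
  C = closedNeighbourhood (tail B) I
  m = ∣ blocksMeeting (tail B) I ∣
  x∈B∩C : x ∈ B zero ∩ C
  x∈B∩C = ∩-monoʳ-⊆ (B zero) (I⊆closedNeighbourhood (tail B) I) x∈B∩I

independent-∪⁅x⁆ : ∀ (B : Blocks n j) {I x} → Independent B I →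
  (∀ a u → u ∈ I → u ∈ B a → x ∉ B a) → Independent B (I ∪ ⁅ x ⁆)
independent-∪⁅x⁆ B {I} {x} indep x∉B u v u∈J v∈J (u≢v , a , u∈B , v∈B)
  with x∈p∪q⁻ I ⁅ x ⁆ u∈J | x∈p∪q⁻ I ⁅ x ⁆ v∈J
... | inj₁ u∈I | inj₁ v∈I = indep u v u∈I v∈I (u≢v , a , u∈B , v∈B)
... | inj₁ u∈I | inj₂ v≡x = x∉B a u u∈I u∈B (subst (_∈ B a) (x∈⁅y⁆⇒x≡y x v≡x) v∈B)
... | inj₂ u≡x | inj₁ v∈I = x∉B a v v∈I v∈B (subst (_∈ B a) (x∈⁅y⁆⇒x≡y x u≡x) u∈B)
... | inj₂ u≡x | inj₂ v≡x = u≢v (trans (x∈⁅y⁆⇒x≡y x u≡x) (sym (x∈⁅y⁆⇒x≡y x v≡x)))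

maximal⇒∈closedNeighbourhood : ∀ (B : Blocks n j) {I} → MaximalIndependent B I →
  ∀ x → x ∈ closedNeighbourhood B I
maximal⇒∈closedNeighbourhood B {I} (indep , maximal) x = decidable-stable (x ∈? N) λ x∉N →
  x∉N (I⊆closedNeighbourhood B I (maximal (I ∪ ⁅ x ⁆) (independent-∪⁅x⁆ B indep (x∉blocksMeeting x∉N))
                                            (p⊆p∪q _) (q⊆p∪q I _ (x∈⁅x⁆ x))))
  where
  N = closedNeighbourhood B I
  x∉blocksMeeting : x ∉ N → ∀ a u → u ∈ I → u ∈ B a → x ∉ B a
  x∉blocksMeeting x∉N a u u∈I u∈B = x∉N ∘ B⊆closedNeighbourhood B I a (u , x∈p∩q⁺ (u∈B , u∈I))

lemma3p13 : (n k p j : ℕ) (B : Blocks n j) → IsLotteryDesign n k p 2 j B →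
    (I : Subset n) → MaximalIndependent B I →
    ⌈ (suc n ∸ p) / (k ∸ 1) ⌉ ≤ ∣ blocksMeeting B I ∣
lemma3p13 n zero          p j B record { t≤k = () }
lemma3p13 n (suc zero)    p j B record { t≤k = s≤s () }
lemma3p13 n (suc (suc k)) p j B design I maximal@(indep , _) =
  m≤n*o⇒⌈m/n⌉≤o (suc n ∸ p) k m (m≤n+o⇒m∸n≤o (suc n) p (begin
    suc n                    ≤⟨ s≤s n≤∣N∣ ⟩
    suc ∣ N ∣                ≤⟨ s≤s (∣closedNeighbourhood∣≤ B I uniform) ⟩
    suc ∣ I ∣ + suc k * m    ≤⟨ +-monoˡ-≤ (suc k * m) (independent⇒∣I∣<p B design indep) ⟩
    p + suc k * m            ∎))
  where
  open IsLotteryDesign design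
  open ≤-Reasoning
  N = closedNeighbourhood B I
  m = ∣ blocksMeeting B I ∣
  n≤∣N∣ : n ≤ ∣ N ∣
  n≤∣N∣ = subst (_≤ ∣ N ∣) (∣⊤∣≡n n)
    (p⊆q⇒∣p∣≤∣q∣ {p = ⊤} (λ {x} _ → maximal⇒∈closedNeighbourhood B maximal x))
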